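{- There exist strictly Deza Cayley graphs with parameters $(14,9,6,4)$, $(22,16,12,10)$ and $(74,64,56,54)$ over dihedral groups (of orders $14$, $22$, $74$ respectively), and for every noncyclic group $A$ of order $16$ there exists a strictly Deza Cayley graph with parameters $(32,25,20,18)$ over the generalized dihedral group $A\rtimes\langle b\rangle$ associated with $A$.
   Context: For a finite abelian group $A$, the generalized dihedral group associated with $A$ is $A\rtimes\langle b\rangle$ with $|b|=2$ and $b^{ -1}ab=a^{ -1}$ for all $a\in A$; when $A$ is cyclic this is a dihedral group. For a finite group $G$ and an inverse-closed subset $S\subseteq G$ not containing the identity, $\mathrm{Cay}(G,S)$ has vertex set $G$ and edges $\{g,xg\}$, $x\in S$. A regular graph is a Deza graph with parameters $(v,k,b,a)$, $a\le b$, if it has $v$ vertices, degree $k$, and any two distinct vertices have either $a$ or $b$ common neighbours. A strictly Deza graph is a Deza graph that is not strongly regular and has diameter $2$. -}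

module Defs where

open import Data.Nat using (ℕ; zero; suc; _+_; _∸_; NonZero)
open import Data.Nat.DivMod using (_mod_)
open import Data.Fin using (Fin; toℕ) renaming (zero to fz; suc to fs)
open import Data.Bool using (Bool; true; false; if_then_else_; _∧_; _xor_)
open import Data.Product using (_×_; _,_; ∃; Σ)
open import Data.Sum using (_⊎_)
open import Relation.Binary.PropositionalEquality using (_≡_; _≢_)
open import Relation.Nullary using (¬_)
open import Algebra.Core using (Op₁; Op₂)

countFin : ∀ {n} → (Fin n → Bool) → ℕ
countFin {zero}  p = 0
countFin {suc n} p = (if p fz then 1 else 0) + countFin (λ i → p (fs i))

-- Elements (a , false) = a, (a , true) = a b.
-- (a , i) · (a' , j) = (a + (-1)^i a' , i xor j).

GD : ℕ → Set
GD n = Fin n × Bool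

module GenDihedral {n : ℕ} (_+_ : Op₂ (Fin n)) (0# : Fin n) (-_ : Op₁ (Fin n)) where

  _·_ : GD n → GD n → GD n
  (a , i) · (a' , j) = (a + (if i then - a' else a')) , (i xor j)

  e : GD n
  e = 0# , false

  inv : GD n → GD n
  inv (a , false) = (- a) , false
  inv (a , true)  = a , true

  cayAdj : (GD n → Bool) → GD n → GD n → Bool
  cayAdj S g h = S (h · inv g)

  IsConnectionSet : (GD n → Bool) → Set
  IsConnectionSet S = (S e ≡ false) × (∀ g → S (inv g) ≡ S g)

module Zmod (m : ℕ) .{{_ : NonZero m}} where
  _+ₘ_ : Op₂ (Fin m)
  a +ₘ b = (toℕ a + toℕ b) mod m

  0ₘ : Fin m
  0ₘ = 0 mod m

  -ₘ_ : Op₁ (Fin m)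
  -ₘ a = (m ∸ toℕ a) mod m

countV : ∀ {n} → (GD n → Bool) → ℕ
countV p = countFin (λ a → p (a , false)) + countFin (λ a → p (a , true))

module GraphOn {n : ℕ} (adj : GD n → GD n → Bool) where

  degree : GD n → ℕ
  degree x = countV (adj x)

  common : GD n → GD n → ℕ
  common x y = countV (λ z → adj x z ∧ adj y z)

  IsDeza : (v k b a : ℕ) → Set
  IsDeza v k b a =
    (v ≡ n + n) × (∀ x → degree x ≡ k) ×
    (∀ x y → x ≢ y → (common x y ≡ a) ⊎ (common x y ≡ b))

  IsSRG : (v k λ' μ : ℕ) → Set
  IsSRG v k λ' μ =
    (v ≡ n + n) × (∀ x → degree x ≡ k) ×
    (∀ x y → x ≢ y → adj x y ≡ true → common x y ≡ λ') ×
    (∀ x y → x ≢ y → adj x y ≡ false → common x y ≡ μ)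

  StronglyRegular : Set
  StronglyRegular = ∃ λ v → ∃ λ k → ∃ λ λ' → ∃ λ μ → IsSRG v k λ' μ

  Diameter2 : Set
  Diameter2 =
    (∀ x y → x ≢ y → (adj x y ≡ true) ⊎ (∃ λ z → (adj x z ∧ adj z y) ≡ true)) ×
    (∃ λ x → ∃ λ y → (x ≢ y) × (adj x y ≡ false))

  IsStrictlyDeza : (v k b a : ℕ) → Set
  IsStrictlyDeza v k b a = IsDeza v k b a × ¬ StronglyRegular × Diameter2

StrictlyDezaCayleyGD : ∀ {n} → Op₂ (Fin n) → Fin n → Op₁ (Fin n) →
                       (v k b a : ℕ) → Set
StrictlyDezaCayleyGD _+_ 0# -_ v k b a =
  Σ (GD _ → Bool) λ S →
    IsConnectionSet S × GraphOn.IsStrictlyDeza (cayAdj S) v k b a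
  where open GenDihedral _+_ 0# -_

-- Dihedral group of order 2m = generalized dihedral group of ℤ/m.
StrictlyDezaCayleyDihedral : (m : ℕ) .{{_ : NonZero m}} → (v k b a : ℕ) → Set
StrictlyDezaCayleyDihedral m = StrictlyDezaCayleyGD _+ₘ_ 0ₘ -ₘ_
  where open Zmod m

multiple : ∀ {n} → Op₂ (Fin n) → Fin n → ℕ → Fin n → Fin n
multiple _+_ 0# zero    g = 0#
multiple _+_ 0# (suc k) g = g + multiple _+_ 0# k g

IsCyclic : ∀ {n} → Op₂ (Fin n) → Fin n → Set
IsCyclic {n} _+_ 0# = ∃ λ (g : Fin n) → ∀ (x : Fin n) → ∃ λ k → multiple _+_ 0# k g ≡ x

-- Let A be an abelian group of order n and T ⊆ A a difference set: |T| = k, and every c ≠ 0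
-- satisfies |T ∩ (T − c)| = λ.  In A ⋊ ⟨b⟩ put S = (A ∖ {0}) ∪ T b.  The number of s ∈ S
-- with s w ∈ S is n − 2 + λ for a rotation w ≠ e, and 2k − 2 or 2k for a reflection w = c b
-- according as c ∈ T or not.  So if n − 2 + λ = 2k, Cay(A ⋊ ⟨b⟩, S) is a Deza graph with
-- parameters (2n, n − 1 + k, 2k, 2k − 2); it is not strongly regular because rotations and
-- reflections in S give different counts, and it has diameter 2.  Suitable difference sets in
-- ℤ₇, ℤ₁₁ and ℤ₃₇ are verified by computation.  A noncyclic abelian group of order 16 contains a
-- subgroup E ≅ ℤ₂ × ℤ₂, because with at most one involution the solutions of 8x = 0 number at
-- most 8, leaving an element of order 16.  Picking, in three of the four cosets of E, a coset
-- of each of the three subgroups of order 2 of E gives a (16, 6, 2) difference set, whose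
-- complement is a (16, 10, 6) difference set.

module Submission where

open import Defs
open import Data.Nat as ℕ using (ℕ; zero; suc; _<_; _∸_; s≤s; z<s; NonZero; _%_; _≡ᵇ_)
open import Data.Nat.Properties as ℕ using ()
open import Data.Nat.DivMod using (_mod_; %-distribˡ-+; m%n%n≡m%n; m<n⇒m%n≡m; n%n≡0)
open import Data.Fin as Fin using (Fin; toℕ; fromℕ<; punchOut; remQuot; combine; #_) renaming (zero to fz; suc to fs)
open import Data.Fin.Patterns using (0F; 1F; 2F; 3F)
open import Data.Fin.Properties as Fin
  using (_≟_; all?; any?; ¬∀⟶∃¬; <⇒notInjective; punchOut-injective; toℕ<n; toℕ≤n; toℕ-fromℕ<; toℕ-injective;
         combine-remQuot)
open import Data.Fin.Permutation using (Permutation′; permutation; _⟨$⟩ʳ_)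
open import Data.Bool using (Bool; true; false; if_then_else_; _∧_; _xor_; not)
open import Data.Bool.Properties using (xor-assoc; xor-same; ∧-zeroʳ; ∧-identityʳ; ∧-comm) renaming (_≟_ to _≟ᵇ_)
open import Data.Bool.ListAction using (any)
open import Data.List as List using (List; []; _∷_; _++_; length; map; concatMap)
open import Data.List.Membership.Propositional using (_∈_; _∉_; lose)
import Data.List.Membership.DecPropositional as DecMembership
open import Data.List.Membership.Propositional.Properties using (∈-map⁺; ∈-++⁺ˡ; ∈-++⁺ʳ; ∈-concatMap⁺)
open import Data.List.Relation.Unary.Any using (here; there; index)
open import Data.List.Relation.Unary.Any.Properties using (lookup-index)
open import Data.Product using (_×_; _,_; ∃; ∃₂; proj₁; proj₂; map₂; uncurry)
open import Data.Product.Properties using (≡-dec)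
open import Data.Sum using (_⊎_; inj₁; inj₂)
open import Data.Vec using (Vec; []; _∷_; lookup; tabulate)
open import Data.Vec.Properties using (lookup∘tabulate)
open import Data.Vec.Functional using (replicate)
open import Function using (_∘_)
open import Function.Bundles using (mk⇔)
open import Function.Definitions using (Injective)
open import Relation.Nullary using (¬_; Dec; yes; no; does; ¬?; contradiction)
open import Relation.Nullary.Decidable
  using (True; map′; dec-true; dec-false; does-⇔; decidable-stable; toWitness; _×-dec_; _⊎-dec_; _→-dec_)
open import Relation.Binary.PropositionalEquality
open import Relation.Binary.Definitions using (tri<; tri≈; tri>)
open import Algebra.Core using (Op₁; Op₂)
open import Algebra.Structures using (IsAbelianGroup)
open import Algebra.Bundles using (AbelianGroup)
import Algebra.Properties.AbelianGroup as AbelianGroupProperties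
import Algebra.Properties.CommutativeSemigroup as CommutativeSemigroupProperties
import Algebra.Properties.CommutativeMonoid.Sum as CommutativeMonoidSum
import Algebra.Properties.Monoid.Mult as MonoidMult

open CommutativeSemigroupProperties ℕ.+-commutativeSemigroup using () renaming (interchange to +-interchange)

indicator : Bool → ℕ
indicator b = if b then 1 else 0

module ℕ-Sum = CommutativeMonoidSum ℕ.+-0-commutativeMonoid

countFin≡sum : ∀ {n} (p : Fin n → Bool) → countFin p ≡ ℕ-Sum.sum (indicator ∘ p)
countFin≡sum {zero}  p = refl
countFin≡sum {suc n} p = cong (indicator (p fz) ℕ.+_) (countFin≡sum (p ∘ fs))

countFin-cong : ∀ {n} {p q : Fin n → Bool} → (∀ i → p i ≡ q i) → countFin p ≡ countFin q
countFin-cong {zero}  p≗q = refl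
countFin-cong {suc n} p≗q = cong₂ (λ b m → indicator b ℕ.+ m) (p≗q fz) (countFin-cong (p≗q ∘ fs))

countFin-permute : ∀ {n} (π : Permutation′ n) (p : Fin n → Bool) →
                   countFin (p ∘ (π ⟨$⟩ʳ_)) ≡ countFin p
countFin-permute π p = begin
  countFin (p ∘ (π ⟨$⟩ʳ_))               ≡⟨ countFin≡sum (p ∘ (π ⟨$⟩ʳ_)) ⟩
  ℕ-Sum.sum (indicator ∘ p ∘ (π ⟨$⟩ʳ_))  ≡⟨ ℕ-Sum.sum-permute (indicator ∘ p) π ⟨
  ℕ-Sum.sum (indicator ∘ p)              ≡⟨ countFin≡sum p ⟨
  countFin p                             ∎
  where open ≡-Reasoning

countFin-remove : ∀ {n} (p : Fin n → Bool) (u : Fin n) →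
                  countFin (λ i → p i ∧ not (does (i ≟ u))) ℕ.+ indicator (p u) ≡ countFin p
countFin-remove {suc n} p fz = begin
  indicator (p fz ∧ false) ℕ.+ countFin (λ i → p (fs i) ∧ true) ℕ.+ indicator (p fz)
    ≡⟨ cong₂ (λ b m → indicator b ℕ.+ m ℕ.+ indicator (p fz))
             (∧-zeroʳ (p fz)) (countFin-cong (λ i → ∧-identityʳ (p (fs i)))) ⟩
  countFin (p ∘ fs) ℕ.+ indicator (p fz)
    ≡⟨ ℕ.+-comm (countFin (p ∘ fs)) (indicator (p fz)) ⟩
  countFin p ∎
  where open ≡-Reasoning
countFin-remove {suc n} p (fs u) = begin
  indicator (p fz ∧ true) ℕ.+ rest ℕ.+ indicator (p (fs u))
    ≡⟨ cong (λ b → indicator b ℕ.+ rest ℕ.+ indicator (p (fs u))) (∧-identityʳ (p fz)) ⟩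
  indicator (p fz) ℕ.+ rest ℕ.+ indicator (p (fs u))
    ≡⟨ ℕ.+-assoc (indicator (p fz)) rest _ ⟩
  indicator (p fz) ℕ.+ (rest ℕ.+ indicator (p (fs u)))
    ≡⟨ cong (indicator (p fz) ℕ.+_) (countFin-remove (p ∘ fs) u) ⟩
  countFin p ∎
  where
  open ≡-Reasoning
  rest = countFin (λ i → p (fs i) ∧ not (does (i ≟ u)))

+1≡⇒≡∸1 : ∀ {x m} → x ℕ.+ 1 ≡ m → x ≡ m ∸ 1
+1≡⇒≡∸1 {x} refl = sym (ℕ.m+n∸n≡m x 1)

countFin-witness : ∀ {n} (p : Fin n → Bool) → 0 < countFin p → ∃ λ i → p i ≡ true
countFin-witness {suc n} p 0<count with p fz in p0
... | true  = fz , p0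
... | false = let i , pi = countFin-witness (p ∘ fs) 0<count in fs i , pi

countFin-true : ∀ n → countFin {n} (λ _ → true) ≡ n
countFin-true zero    = refl
countFin-true (suc n) = cong suc (countFin-true n)

indicator-inclusion–exclusion : ∀ a b →
  indicator (not a ∧ not b) ℕ.+ (indicator a ℕ.+ indicator b) ≡ 1 ℕ.+ indicator (a ∧ b)
indicator-inclusion–exclusion false false = refl
indicator-inclusion–exclusion false true  = refl
indicator-inclusion–exclusion true  false = refl
indicator-inclusion–exclusion true  true  = refl

countFin-inclusion–exclusion : ∀ {n} (p q : Fin n → Bool) →
  countFin (λ i → not (p i) ∧ not (q i)) ℕ.+ (countFin p ℕ.+ countFin q) ≡
  n ℕ.+ countFin (λ i → p i ∧ q i)
countFin-inclusion–exclusion {zero}  p q = refl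
countFin-inclusion–exclusion {suc n} p q = begin
  (indicator (not a ∧ not b) ℕ.+ neither) ℕ.+ ((indicator a ℕ.+ countP) ℕ.+ (indicator b ℕ.+ countQ))
    ≡⟨ cong ((indicator (not a ∧ not b) ℕ.+ neither) ℕ.+_) (+-interchange (indicator a) countP (indicator b) countQ) ⟩
  (indicator (not a ∧ not b) ℕ.+ neither) ℕ.+ ((indicator a ℕ.+ indicator b) ℕ.+ (countP ℕ.+ countQ))
    ≡⟨ +-interchange (indicator (not a ∧ not b)) neither _ _ ⟩
  (indicator (not a ∧ not b) ℕ.+ (indicator a ℕ.+ indicator b)) ℕ.+ (neither ℕ.+ (countP ℕ.+ countQ))
    ≡⟨ cong₂ ℕ._+_ (indicator-inclusion–exclusion a b) (countFin-inclusion–exclusion (p ∘ fs) (q ∘ fs)) ⟩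
  (1 ℕ.+ indicator (a ∧ b)) ℕ.+ (n ℕ.+ both)
    ≡⟨ +-interchange 1 (indicator (a ∧ b)) n both ⟩
  suc n ℕ.+ countFin (λ i → p i ∧ q i) ∎
  where
  open ≡-Reasoning
  a = p fz
  b = q fz
  neither = countFin (λ i → not (p (fs i)) ∧ not (q (fs i)))
  countP = countFin (p ∘ fs)
  countQ = countFin (q ∘ fs)
  both = countFin (λ i → p (fs i) ∧ q (fs i))

indicator-not : ∀ a → indicator (not a) ℕ.+ indicator a ≡ 1
indicator-not false = refl
indicator-not true  = refl

countFin-not : ∀ {n} (p : Fin n → Bool) → countFin (not ∘ p) ℕ.+ countFin p ≡ n
countFin-not {zero}  p = refl
countFin-not {suc n} p = begin
  (indicator (not (p fz)) ℕ.+ countFin (not ∘ p ∘ fs)) ℕ.+ (indicator (p fz) ℕ.+ countFin (p ∘ fs))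
    ≡⟨ +-interchange (indicator (not (p fz))) _ _ _ ⟩
  (indicator (not (p fz)) ℕ.+ indicator (p fz)) ℕ.+ (countFin (not ∘ p ∘ fs) ℕ.+ countFin (p ∘ fs))
    ≡⟨ cong₂ ℕ._+_ (indicator-not (p fz)) (countFin-not (p ∘ fs)) ⟩
  suc n ∎
  where open ≡-Reasoning

countV-cong : ∀ {n} {p q : GD n → Bool} → (∀ x → p x ≡ q x) → countV p ≡ countV q
countV-cong p≗q = cong₂ ℕ._+_ (countFin-cong (λ a → p≗q (a , false)))
                              (countFin-cong (λ a → p≗q (a , true)))

countV-witness : ∀ {n} (p : GD n → Bool) → 0 < countV p → ∃ λ x → p x ≡ true
countV-witness p 0<count with countFin (λ a → p (a , false)) in count₀
... | zero  = let a , pa = countFin-witness (λ a → p (a , true)) 0<count in (a , true) , pa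
... | suc _ = let a , pa = countFin-witness (λ a → p (a , false)) (subst (0 <_) (sym count₀) z<s)
              in (a , false) , pa

-- Opaque: witnesses found by exhaustive search are prohibitively expensive to unfold during
-- conversion checking.
opaque
  ∃∉ : ∀ {n} (xs : List (Fin n)) → length xs < n → ∃ λ x → x ∉ xs
  ∃∉ {n} xs |xs|<n = ¬∀⟶∃¬ n (_∈ xs) (λ x → DecMembership._∈?_ _≟_ x xs) λ all∈ →
    <⇒notInjective {f = index ∘ all∈} |xs|<n λ {x} {y} eq →
      trans (lookup-index (all∈ x)) (trans (cong (List.lookup xs) eq) (sym (lookup-index (all∈ y))))

  injective⇒preimage : ∀ {n} {f : Fin n → Fin n} → Injective _≡_ _≡_ f → ∀ y → ∃ λ x → f x ≡ y
  injective⇒preimage {suc n} {f} f-injective y = decidable-stable (any? λ x → f x ≟ y) λ ∄x →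
    <⇒notInjective {f = λ x → punchOut {i = y} {j = f x} (∄x ∘ (x ,_) ∘ sym)} (ℕ.n<1+n n)
      (f-injective ∘ punchOut-injective (∄x ∘ (_ ,_) ∘ sym) (∄x ∘ (_ ,_) ∘ sym))

-- Deza Cayley graphs over generalised dihedral groups

module AbelianGroupOnFin {n : ℕ} {_+_ : Op₂ (Fin n)} {0# : Fin n} { -_ : Op₁ (Fin n)}
                         (isAbelianGroup : IsAbelianGroup _≡_ _+_ 0# -_) where

  abelianGroup : AbelianGroup _ _
  abelianGroup = record { isAbelianGroup = isAbelianGroup }

  open AbelianGroup abelianGroup public using (assoc; comm; identityˡ; identityʳ; inverseˡ; inverseʳ)
  open AbelianGroupProperties abelianGroup public
    using (⁻¹-involutive; ε⁻¹≈ε; ⁻¹-∙-comm; x∙y⁻¹≈ε⇒x≈y; ∙-cancelˡ; ∙-cancelʳ; identityʳ-unique;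
           //-rightDividesˡ; //-rightDividesʳ)
  open CommutativeSemigroupProperties (AbelianGroup.commutativeSemigroup abelianGroup) public
    using (interchange; xy∙z≈xz∙y)
  open ≡-Reasoning

  translation : Fin n → Permutation′ n
  translation u = permutation (_+ u) (_+ (- u)) (//-rightDividesˡ u) (//-rightDividesʳ u)

  countFin-translate : ∀ u (q : Fin n → Bool) → countFin (λ a → q (a + u)) ≡ countFin q
  countFin-translate u = countFin-permute (translation u)

  IsDifferenceSet : (Fin n → Bool) → ℕ → Set
  IsDifferenceSet T λ′ = ∀ c → c ≢ 0# → countFin (λ a → T a ∧ T (a + c)) ≡ λ′

  nonzero : Fin n → Bool
  nonzero a = not (does (a ≟ 0#))

  countFin-nonzero : countFin nonzero ≡ n ∸ 1
  countFin-nonzero = +1≡⇒≡∸1 (trans (countFin-remove (λ _ → true) 0#) (countFin-true n))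

  -≢0 : ∀ {c} → c ≢ 0# → - c ≢ 0#
  -≢0 {c} c≢0 -c≡0 = c≢0 (trans (sym (⁻¹-involutive c)) (trans (cong -_ -c≡0) ε⁻¹≈ε))

  complement-isDifferenceSet : ∀ {k λ′} (Z : Fin n → Bool) → countFin Z ≡ k → IsDifferenceSet Z λ′ →
                               IsDifferenceSet (not ∘ Z) (n ℕ.+ λ′ ∸ (k ℕ.+ k))
  complement-isDifferenceSet {k} {λ′} Z |Z|≡k Z-difference c c≢0 = begin
    neither                                           ≡⟨ ℕ.m+n∸n≡m neither (k ℕ.+ k) ⟨
    neither ℕ.+ (k ℕ.+ k) ∸ (k ℕ.+ k)                 ≡⟨ cong (λ m → neither ℕ.+ m ∸ (k ℕ.+ k)) counts ⟨
    neither ℕ.+ (countFin Z ℕ.+ countFin (Z ∘ (_+ c))) ∸ (k ℕ.+ k)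
      ≡⟨ cong (_∸ (k ℕ.+ k)) (countFin-inclusion–exclusion Z (Z ∘ (_+ c))) ⟩
    n ℕ.+ countFin (λ a → Z a ∧ Z (a + c)) ∸ (k ℕ.+ k)
      ≡⟨ cong (λ m → n ℕ.+ m ∸ (k ℕ.+ k)) (Z-difference c c≢0) ⟩
    n ℕ.+ λ′ ∸ (k ℕ.+ k)                              ∎
    where
    neither = countFin (λ a → not (Z a) ∧ not (Z (a + c)))
    counts : countFin Z ℕ.+ countFin (Z ∘ (_+ c)) ≡ k ℕ.+ k
    counts = cong₂ ℕ._+_ |Z|≡k (trans (countFin-translate c Z) |Z|≡k)

  nonzero-≢0 : ∀ {a} → a ≢ 0# → nonzero a ≡ true
  nonzero-≢0 {a} a≢0 = cong not (dec-false (a ≟ 0#) a≢0)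

  nonzero-difference : ∀ a c → nonzero (a + (- c)) ≡ not (does (a ≟ c))
  nonzero-difference a c =
    cong not (does-⇔ (mk⇔ (x∙y⁻¹≈ε⇒x≈y a c) (λ { refl → inverseʳ a })) ((a + (- c)) ≟ 0#) (a ≟ c))

module GeneralisedDihedralGroup {n : ℕ} {_+_ : Op₂ (Fin n)} {0# : Fin n} { -_ : Op₁ (Fin n)}
                                (isAbelianGroup : IsAbelianGroup _≡_ _+_ 0# -_) where

  open AbelianGroupOnFin isAbelianGroup public
  open GenDihedral _+_ 0# -_ public
  open ≡-Reasoning

  sign : Bool → Fin n → Fin n
  sign i a = if i then - a else a

  sign-+ : ∀ i a b → sign i (a + b) ≡ sign i a + sign i b
  sign-+ false a b = refl
  sign-+ true  a b = sym (⁻¹-∙-comm a b)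

  sign-sign : ∀ i j a → sign i (sign j a) ≡ sign (i xor j) a
  sign-sign false j     a = refl
  sign-sign true  false a = refl
  sign-sign true  true  a = ⁻¹-involutive a

  ·-def : ∀ a i b j → (a , i) · (b , j) ≡ (a + sign i b , i xor j)
  ·-def a false b j = refl
  ·-def a true  b j = refl

  ·-assoc : ∀ x y z → (x · y) · z ≡ x · (y · z)
  ·-assoc (a , i) (b , j) (c , k) = begin
    ((a , i) · (b , j)) · (c , k)         ≡⟨ cong (_· (c , k)) (·-def a i b j) ⟩
    (a + sign i b , i xor j) · (c , k)    ≡⟨ ·-def _ _ c k ⟩
    ((a + sign i b) + sign (i xor j) c , (i xor j) xor k)
      ≡⟨ cong₂ _,_ first-component (xor-assoc i j k) ⟩
    (a + sign i (b + sign j c) , i xor (j xor k)) ≡⟨ ·-def a i _ _ ⟨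
    (a , i) · (b + sign j c , j xor k)    ≡⟨ cong ((a , i) ·_) (·-def b j c k) ⟨
    (a , i) · ((b , j) · (c , k))         ∎
    where
    first-component : (a + sign i b) + sign (i xor j) c ≡ a + sign i (b + sign j c)
    first-component = begin
      (a + sign i b) + sign (i xor j) c   ≡⟨ assoc a _ _ ⟩
      a + (sign i b + sign (i xor j) c)   ≡⟨ cong (λ z → a + (sign i b + z)) (sign-sign i j c) ⟨
      a + (sign i b + sign i (sign j c))  ≡⟨ cong (a +_) (sign-+ i b (sign j c)) ⟨
      a + sign i (b + sign j c)           ∎

  ·-inverseʳ : ∀ x → x · inv x ≡ e
  ·-inverseʳ (a , false) = cong (_, false) (inverseʳ a)
  ·-inverseʳ (a , true)  = cong (_, false) (inverseʳ a)

  ·-identityʳ : ∀ x → x · e ≡ x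
  ·-identityʳ (a , false) = cong (_, false) (identityʳ a)
  ·-identityʳ (a , true)  = cong (_, true) (trans (cong (a +_) ε⁻¹≈ε) (identityʳ a))

  ·-identityˡ : ∀ x → e · x ≡ x
  ·-identityˡ (a , false) = cong (_, false) (identityˡ a)
  ·-identityˡ (a , true)  = cong (_, true) (identityˡ a)

  inv-e : inv e ≡ e
  inv-e = cong (_, false) ε⁻¹≈ε

  x·e⁻¹≡x : ∀ x → x · inv e ≡ x
  x·e⁻¹≡x x = trans (cong (x ·_) inv-e) (·-identityʳ x)

  xy⁻¹y≡x : ∀ x y → (x · y) · inv y ≡ x
  xy⁻¹y≡x x y = trans (·-assoc x y (inv y)) (trans (cong (x ·_) (·-inverseʳ y)) (·-identityʳ x))

  inv-x·y⁻¹ : ∀ x y → inv (x · inv y) ≡ y · inv x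
  inv-x·y⁻¹ (a , false) (b , false) = cong (_, false) (begin
    - (a + (- b))       ≡⟨ ⁻¹-∙-comm a (- b) ⟨
    (- a) + (- (- b))   ≡⟨ cong ((- a) +_) (⁻¹-involutive b) ⟩
    (- a) + b           ≡⟨ comm (- a) b ⟩
    b + (- a)           ∎)
  inv-x·y⁻¹ (a , false) (b , true)  = cong (_, true) (trans (comm a b) (cong (b +_) (sym (⁻¹-involutive a))))
  inv-x·y⁻¹ (a , true)  (b , false) = cong (_, true) (trans (cong (a +_) (⁻¹-involutive b)) (comm a b))
  inv-x·y⁻¹ (a , true)  (b , true)  = inv-x·y⁻¹ (a , false) (b , false)

  x·y⁻¹≡e⇒x≡y : ∀ x y → x · inv y ≡ e → x ≡ y
  x·y⁻¹≡e⇒x≡y (a , false) (b , false) xy⁻¹≡e = cong (_, false) (x∙y⁻¹≈ε⇒x≈y a b (cong proj₁ xy⁻¹≡e))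
  x·y⁻¹≡e⇒x≡y (a , true)  (b , true)  xy⁻¹≡e = cong (_, true) (x∙y⁻¹≈ε⇒x≈y a b (cong proj₁ xy⁻¹≡e))

  countV-·ʳ : ∀ x (p : GD n → Bool) → countV (λ s → p (s · x)) ≡ countV p
  countV-·ʳ (c , false) p = cong₂ ℕ._+_ (countFin-translate c (λ a → p (a , false)))
                                        (countFin-translate (- c) (λ a → p (a , true)))
  countV-·ʳ (c , true)  p = trans (cong₂ ℕ._+_ (countFin-translate c (λ a → p (a , true)))
                                                (countFin-translate (- c) (λ a → p (a , false))))
                                  (ℕ.+-comm (countFin (λ a → p (a , true))) _)

  module CayleyGraph (S : GD n → Bool) (S-connection : IsConnectionSet S) where
    open GraphOn (cayAdj S)

    coincidences : GD n → ℕ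
    coincidences w = countV (λ s → S s ∧ S (s · w))

    common≡coincidences : ∀ x y → common x y ≡ coincidences (x · inv y)
    common≡coincidences x y = begin
      countV (λ z → S (z · inv x) ∧ S (z · inv y))
        ≡⟨ countV-·ʳ x (λ z → S (z · inv x) ∧ S (z · inv y)) ⟨
      countV (λ s → S ((s · x) · inv x) ∧ S ((s · x) · inv y))
        ≡⟨ countV-cong (λ s → cong₂ (λ u v → S u ∧ S v) (xy⁻¹y≡x s x) (·-assoc s x (inv y))) ⟩
      coincidences (x · inv y) ∎

    degree≡countV : ∀ x → degree x ≡ countV S
    degree≡countV x = trans (sym (countV-·ʳ x (λ z → S (z · inv x))))
                            (countV-cong (λ s → cong S (xy⁻¹y≡x s x)))

    cayAdj-sym : ∀ y z → cayAdj S y z ≡ cayAdj S z y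
    cayAdj-sym y z = trans (sym (proj₂ S-connection (z · inv y))) (cong S (inv-x·y⁻¹ z y))

    cayAdj-e : ∀ w → cayAdj S w e ≡ S w
    cayAdj-e w = trans (cong S (·-identityˡ (inv w))) (proj₂ S-connection w)

    common-e : ∀ w → common w e ≡ coincidences w
    common-e w = trans (common≡coincidences w e) (cong coincidences (x·e⁻¹≡x w))

    ∈S⇒≢e : ∀ w → S w ≡ true → w ≢ e
    ∈S⇒≢e w w∈S refl with () ← trans (sym w∈S) (proj₁ S-connection)

    isDeza : ∀ {k a b} → countV S ≡ k → (∀ w → w ≢ e → coincidences w ≡ a ⊎ coincidences w ≡ b) →
             IsDeza (n ℕ.+ n) k b a
    isDeza |S|≡k values = refl , (λ x → trans (degree≡countV x) |S|≡k) , common-values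
      where
      common-values : ∀ x y → x ≢ y → common x y ≡ _ ⊎ common x y ≡ _
      common-values x y x≢y rewrite common≡coincidences x y = values _ (x≢y ∘ x·y⁻¹≡e⇒x≡y x y)

    ¬stronglyRegular : ∀ w₁ w₂ → S w₁ ≡ true → S w₂ ≡ true → coincidences w₁ ≢ coincidences w₂ →
                       ¬ StronglyRegular
    ¬stronglyRegular w₁ w₂ w₁∈S w₂∈S differ (_ , _ , λ′ , _ , _ , _ , common-adjacent , _) = differ (begin
      coincidences w₁  ≡⟨ common-e w₁ ⟨
      common w₁ e      ≡⟨ common-adjacent w₁ e (∈S⇒≢e w₁ w₁∈S) (trans (cayAdj-e w₁) w₁∈S) ⟩
      λ′               ≡⟨ common-adjacent w₂ e (∈S⇒≢e w₂ w₂∈S) (trans (cayAdj-e w₂) w₂∈S) ⟨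
      common w₂ e      ≡⟨ common-e w₂ ⟩
      coincidences w₂  ∎)

    diameter2 : (∀ w → w ≢ e → 0 < coincidences w) → ∀ w → w ≢ e → S w ≡ false → Diameter2
    diameter2 positive w w≢e w∉S = within-2 , (e , w , w≢e ∘ sym , trans (cong S (x·e⁻¹≡x w)) w∉S)
      where
      within-2 : ∀ x y → x ≢ y → cayAdj S x y ≡ true ⊎ ∃ λ z → (cayAdj S x z ∧ cayAdj S z y) ≡ true
      within-2 x y x≢y =
        let z , xz∧yz = countV-witness (λ z → cayAdj S x z ∧ cayAdj S y z)
                          (subst (0 <_) (sym (common≡coincidences x y)) (positive _ (x≢y ∘ x·y⁻¹≡e⇒x≡y x y)))
        in inj₂ (z , trans (cong (cayAdj S x z ∧_) (cayAdj-sym z y)) xz∧yz)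

    isStrictlyDeza : ∀ {k a b} → 0 < a → 0 < b → countV S ≡ k →
                     (∀ w → w ≢ e → coincidences w ≡ a ⊎ coincidences w ≡ b) →
                     ∀ w₁ w₂ → S w₁ ≡ true → S w₂ ≡ true → coincidences w₁ ≢ coincidences w₂ →
                     ∀ w₃ → w₃ ≢ e → S w₃ ≡ false →
                     IsStrictlyDeza (n ℕ.+ n) k b a
    isStrictlyDeza 0<a 0<b |S|≡k values w₁ w₂ w₁∈S w₂∈S differ w₃ w₃≢e w₃∉S =
      isDeza |S|≡k values , ¬stronglyRegular w₁ w₂ w₁∈S w₂∈S differ , diameter2 positive w₃ w₃≢e w₃∉S
      where
      positive : ∀ w → w ≢ e → 0 < coincidences w
      positive w w≢e with values w w≢e
      ... | inj₁ ≡a = subst (0 <_) (sym ≡a) 0<a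
      ... | inj₂ ≡b = subst (0 <_) (sym ≡b) 0<b

  connectionSet : (Fin n → Bool) → GD n → Bool
  connectionSet T (a , false) = nonzero a
  connectionSet T (a , true)  = T a

  connectionSet-isConnectionSet : ∀ T → IsConnectionSet (connectionSet T)
  connectionSet-isConnectionSet T = cong not (dec-true (0# ≟ 0#) refl) , inverse-closed
    where
    inverse-closed : ∀ g → connectionSet T (inv g) ≡ connectionSet T g
    inverse-closed (a , false) = begin
      nonzero (- a)           ≡⟨ cong nonzero (identityˡ (- a)) ⟨
      nonzero (0# + (- a))    ≡⟨ nonzero-difference 0# a ⟩
      not (does (0# ≟ a))     ≡⟨ cong not (does-⇔ (mk⇔ sym sym) (0# ≟ a) (a ≟ 0#)) ⟩
      nonzero a               ∎
    inverse-closed (a , true)  = refl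

  module DifferenceSetConstruction {k′ λ′} (T : Fin n → Bool)
           (|T|≡1+k′ : countFin T ≡ suc k′) (T-difference : IsDifferenceSet T λ′) where
    open CayleyGraph (connectionSet T) (connectionSet-isConnectionSet T) public

    coincidences-rotation : ∀ c → c ≢ 0# → coincidences (c , false) ≡ n ∸ 2 ℕ.+ λ′
    coincidences-rotation c c≢0 = cong₂ ℕ._+_ rotations (T-difference (- c) (-≢0 c≢0))
      where
      rotations : countFin (λ a → nonzero a ∧ nonzero (a + c)) ≡ n ∸ 2
      rotations = trans (+1≡⇒≡∸1 (begin
        countFin (λ a → nonzero a ∧ nonzero (a + c)) ℕ.+ 1
          ≡⟨ cong₂ ℕ._+_ (countFin-cong (λ a → ∧-comm (nonzero (a + c)) (nonzero a)))
                         (cong indicator (nonzero-≢0 (c≢0 ∘ trans (sym (identityˡ c))))) ⟨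
        countFin (λ a → nonzero (a + c) ∧ nonzero a) ℕ.+ indicator (nonzero (0# + c))
          ≡⟨ countFin-remove (nonzero ∘ (_+ c)) 0# ⟩
        countFin (nonzero ∘ (_+ c))  ≡⟨ countFin-translate c nonzero ⟩
        countFin nonzero             ≡⟨ countFin-nonzero ⟩
        n ∸ 1                        ∎)) (ℕ.∸-+-assoc n 1 1)

    reflection-rotationPart : ∀ c → countFin (λ a → nonzero a ∧ T (a + c)) ℕ.+ indicator (T c) ≡ suc k′
    reflection-rotationPart c = begin
      countFin (λ a → nonzero a ∧ T (a + c)) ℕ.+ indicator (T c)
        ≡⟨ cong₂ ℕ._+_ (countFin-cong (λ a → ∧-comm (T (a + c)) (nonzero a))) (cong (indicator ∘ T) (identityˡ c)) ⟨
      countFin (λ a → T (a + c) ∧ nonzero a) ℕ.+ indicator (T (0# + c))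
        ≡⟨ countFin-remove (T ∘ (_+ c)) 0# ⟩
      countFin (T ∘ (_+ c))  ≡⟨ countFin-translate c T ⟩
      countFin T             ≡⟨ |T|≡1+k′ ⟩
      suc k′                 ∎

    reflection-reflectionPart : ∀ c → countFin (λ a → T a ∧ nonzero (a + (- c))) ℕ.+ indicator (T c) ≡ suc k′
    reflection-reflectionPart c = begin
      countFin (λ a → T a ∧ nonzero (a + (- c))) ℕ.+ indicator (T c)
        ≡⟨ cong (ℕ._+ indicator (T c)) (countFin-cong (λ a → cong (T a ∧_) (nonzero-difference a c))) ⟩
      countFin (λ a → T a ∧ not (does (a ≟ c))) ℕ.+ indicator (T c)
        ≡⟨ countFin-remove T c ⟩
      countFin T             ≡⟨ |T|≡1+k′ ⟩
      suc k′                 ∎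

    coincidences-reflection∈T : ∀ c → T c ≡ true → coincidences (c , true) ≡ k′ ℕ.+ k′
    coincidences-reflection∈T c c∈T = cong₂ ℕ._+_ (half (reflection-rotationPart c))
                                                  (half (reflection-reflectionPart c))
      where
      half : ∀ {x} → x ℕ.+ indicator (T c) ≡ suc k′ → x ≡ k′
      half {x} x+[c∈T]≡1+k′ rewrite c∈T = +1≡⇒≡∸1 x+[c∈T]≡1+k′

    coincidences-reflection∉T : ∀ c → T c ≡ false → coincidences (c , true) ≡ suc k′ ℕ.+ suc k′
    coincidences-reflection∉T c c∉T = cong₂ ℕ._+_ (half (reflection-rotationPart c))
                                                  (half (reflection-reflectionPart c))
      where
      half : ∀ {x} → x ℕ.+ indicator (T c) ≡ suc k′ → x ≡ suc k′
      half {x} x+[c∈T]≡1+k′ rewrite c∉T = trans (sym (ℕ.+-identityʳ x)) x+[c∈T]≡1+k′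

  differenceSet⇒strictlyDezaCayley :
    ∀ {k′ λ′} (T : Fin n → Bool) → countFin T ≡ suc k′ → 0 < k′ → IsDifferenceSet T λ′ →
    n ∸ 2 ℕ.+ λ′ ≡ suc k′ ℕ.+ suc k′ → ∀ u → T u ≡ false →
    StrictlyDezaCayleyGD _+_ 0# -_ (n ℕ.+ n) (n ∸ 1 ℕ.+ suc k′) (suc k′ ℕ.+ suc k′) (k′ ℕ.+ k′)
  differenceSet⇒strictlyDezaCayley {k′} {λ′} T |T|≡1+k′ 0<k′ T-difference rotation-value u u∉T =
    connectionSet T , connectionSet-isConnectionSet T ,
    isStrictlyDeza (ℕ.<-≤-trans 0<k′ (ℕ.m≤m+n k′ k′)) z<s (cong₂ ℕ._+_ countFin-nonzero |T|≡1+k′) values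
                   (t , true) (t + (- u) , false) t∈T (nonzero-≢0 t-u≢0) differ (u , true) (λ ()) u∉T
    where
    open DifferenceSetConstruction T |T|≡1+k′ T-difference
    member : ∃ λ t → T t ≡ true
    member = countFin-witness T (subst (0 <_) (sym |T|≡1+k′) z<s)
    t = proj₁ member
    t∈T = proj₂ member
    t-u≢0 : t + (- u) ≢ 0#
    t-u≢0 t-u≡0 with () ← trans (sym t∈T) (trans (cong T (x∙y⁻¹≈ε⇒x≈y t u t-u≡0)) u∉T)
    values : ∀ w → w ≢ e → coincidences w ≡ k′ ℕ.+ k′ ⊎ coincidences w ≡ suc k′ ℕ.+ suc k′
    values (c , false) w≢e = inj₂ (trans (coincidences-rotation c (w≢e ∘ cong (_, false))) rotation-value)
    values (c , true)  _ with T c in c∈T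
    ... | true  = inj₁ (coincidences-reflection∈T c c∈T)
    ... | false = inj₂ (coincidences-reflection∉T c c∈T)
    differ : coincidences (t , true) ≢ coincidences (t + (- u) , false)
    differ eq = ℕ.<⇒≢ (ℕ.+-mono-< (ℕ.n<1+n k′) (ℕ.n<1+n k′)) (begin
      k′ ℕ.+ k′                       ≡⟨ coincidences-reflection∈T t t∈T ⟨
      coincidences (t , true)         ≡⟨ eq ⟩
      coincidences (t + (- u) , false) ≡⟨ coincidences-rotation (t + (- u)) t-u≢0 ⟩
      n ∸ 2 ℕ.+ λ′                    ≡⟨ rotation-value ⟩
      suc k′ ℕ.+ suc k′               ∎)

-- Dihedral groups

module _ (m : ℕ) .{{_ : NonZero m}} where
  open Zmod m
  open ≡-Reasoning

  %-absorbˡ : ∀ x y → (x % m ℕ.+ y) % m ≡ (x ℕ.+ y) % m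
  %-absorbˡ x y = begin
    (x % m ℕ.+ y) % m              ≡⟨ %-distribˡ-+ (x % m) y m ⟩
    (x % m % m ℕ.+ y % m) % m      ≡⟨ cong (λ t → (t ℕ.+ y % m) % m) (m%n%n≡m%n x m) ⟩
    (x % m ℕ.+ y % m) % m          ≡⟨ %-distribˡ-+ x y m ⟨
    (x ℕ.+ y) % m                  ∎

  %-absorbʳ : ∀ x y → (x ℕ.+ y % m) % m ≡ (x ℕ.+ y) % m
  %-absorbʳ x y = begin
    (x ℕ.+ y % m) % m   ≡⟨ cong (_% m) (ℕ.+-comm x (y % m)) ⟩
    (y % m ℕ.+ x) % m   ≡⟨ %-absorbˡ y x ⟩
    (y ℕ.+ x) % m       ≡⟨ cong (_% m) (ℕ.+-comm y x) ⟩
    (x ℕ.+ y) % m       ∎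

  toℕ-+ₘ : ∀ a b → toℕ (a +ₘ b) ≡ (toℕ a ℕ.+ toℕ b) % m
  toℕ-+ₘ a b = toℕ-fromℕ< _

  toℕ-0ₘ : toℕ 0ₘ ≡ 0
  toℕ-0ₘ = trans (toℕ-fromℕ< _) (m<n⇒m%n≡m (ℕ.>-nonZero⁻¹ m))

  toℕ-% : ∀ (a : Fin m) → toℕ a % m ≡ toℕ a
  toℕ-% a = m<n⇒m%n≡m (toℕ<n a)

  +ₘ-assoc : ∀ a b c → (a +ₘ b) +ₘ c ≡ a +ₘ (b +ₘ c)
  +ₘ-assoc a b c = toℕ-injective (begin
    toℕ ((a +ₘ b) +ₘ c)                   ≡⟨ toℕ-+ₘ (a +ₘ b) c ⟩
    (toℕ (a +ₘ b) ℕ.+ toℕ c) % m          ≡⟨ cong (λ t → (t ℕ.+ toℕ c) % m) (toℕ-+ₘ a b) ⟩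
    ((toℕ a ℕ.+ toℕ b) % m ℕ.+ toℕ c) % m ≡⟨ %-absorbˡ (toℕ a ℕ.+ toℕ b) (toℕ c) ⟩
    (toℕ a ℕ.+ toℕ b ℕ.+ toℕ c) % m       ≡⟨ cong (_% m) (ℕ.+-assoc (toℕ a) (toℕ b) (toℕ c)) ⟩
    (toℕ a ℕ.+ (toℕ b ℕ.+ toℕ c)) % m     ≡⟨ %-absorbʳ (toℕ a) (toℕ b ℕ.+ toℕ c) ⟨
    (toℕ a ℕ.+ (toℕ b ℕ.+ toℕ c) % m) % m ≡⟨ cong (λ t → (toℕ a ℕ.+ t) % m) (toℕ-+ₘ b c) ⟨
    (toℕ a ℕ.+ toℕ (b +ₘ c)) % m          ≡⟨ toℕ-+ₘ a (b +ₘ c) ⟨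
    toℕ (a +ₘ (b +ₘ c))                   ∎)

  +ₘ-comm : ∀ a b → a +ₘ b ≡ b +ₘ a
  +ₘ-comm a b = cong (_mod m) (ℕ.+-comm (toℕ a) (toℕ b))

  +ₘ-identityˡ : ∀ a → 0ₘ +ₘ a ≡ a
  +ₘ-identityˡ a = toℕ-injective (begin
    toℕ (0ₘ +ₘ a)               ≡⟨ toℕ-+ₘ 0ₘ a ⟩
    (toℕ 0ₘ ℕ.+ toℕ a) % m      ≡⟨ cong (λ t → (t ℕ.+ toℕ a) % m) toℕ-0ₘ ⟩
    toℕ a % m                   ≡⟨ toℕ-% a ⟩
    toℕ a                       ∎)

  -ₘ-inverseˡ : ∀ a → (-ₘ a) +ₘ a ≡ 0ₘ
  -ₘ-inverseˡ a = toℕ-injective (begin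
    toℕ ((-ₘ a) +ₘ a)                   ≡⟨ toℕ-+ₘ (-ₘ a) a ⟩
    (toℕ (-ₘ a) ℕ.+ toℕ a) % m          ≡⟨ cong (λ t → (t ℕ.+ toℕ a) % m) (toℕ-fromℕ< _) ⟩
    ((m ∸ toℕ a) % m ℕ.+ toℕ a) % m     ≡⟨ %-absorbˡ (m ∸ toℕ a) (toℕ a) ⟩
    (m ∸ toℕ a ℕ.+ toℕ a) % m           ≡⟨ cong (_% m) (ℕ.m∸n+n≡m (toℕ≤n a)) ⟩
    m % m                               ≡⟨ n%n≡0 m ⟩
    0                                   ≡⟨ toℕ-0ₘ ⟨
    toℕ 0ₘ                              ∎)

  Zmod-isAbelianGroup : IsAbelianGroup _≡_ _+ₘ_ 0ₘ -ₘ_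
  Zmod-isAbelianGroup = record
    { isGroup = record
      { isMonoid = record
        { isSemigroup = record
          { isMagma = record { isEquivalence = isEquivalence ; ∙-cong = cong₂ _+ₘ_ }
          ; assoc = +ₘ-assoc
          }
        ; identity = +ₘ-identityˡ , λ a → trans (+ₘ-comm a 0ₘ) (+ₘ-identityˡ a)
        }
      ; inverse = -ₘ-inverseˡ , λ a → trans (+ₘ-comm a (-ₘ a)) (-ₘ-inverseˡ a)
      ; ⁻¹-cong = cong -ₘ_
      }
    ; comm = +ₘ-comm
    }

module DihedralGroup (m : ℕ) .{{_ : NonZero m}} where
  open Zmod m
  open GeneralisedDihedralGroup (Zmod-isAbelianGroup m) public

  residues : List ℕ → Fin m → Bool
  residues D a = any (_≡ᵇ toℕ a) D

  isDifferenceSet? : ∀ T λ′ → Dec (IsDifferenceSet T λ′)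
  isDifferenceSet? T λ′ = all? λ c → ¬? (c ≟ 0ₘ) →-dec (countFin (λ a → T a ∧ T (a +ₘ c)) ℕ.≟ λ′)

strictlyDeza-14 : StrictlyDezaCayleyDihedral 7 14 9 6 4
strictlyDeza-14 = differenceSet⇒strictlyDezaCayley T refl z<s (toWitness {a? = isDifferenceSet? T 1} _) refl (# 0) refl
  where
  open DihedralGroup 7
  T = residues (1 ∷ 2 ∷ 4 ∷ [])

strictlyDeza-22 : StrictlyDezaCayleyDihedral 11 22 16 12 10
strictlyDeza-22 = differenceSet⇒strictlyDezaCayley T refl z<s (toWitness {a? = isDifferenceSet? T 3} _) refl (# 1) refl
  where
  open DihedralGroup 11
  T = residues (0 ∷ 2 ∷ 6 ∷ 7 ∷ 8 ∷ 10 ∷ [])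

strictlyDeza-74 : StrictlyDezaCayleyDihedral 37 74 64 56 54
strictlyDeza-74 = differenceSet⇒strictlyDezaCayley T refl z<s (toWitness {a? = isDifferenceSet? T 21} _) refl (# 1) refl
  where
  open DihedralGroup 37
  T = residues (0 ∷ 2 ∷ 3 ∷ 4 ∷ 5 ∷ 6 ∷ 8 ∷ 11 ∷ 13 ∷ 14 ∷ 15 ∷ 17 ∷ 18 ∷ 19 ∷
                20 ∷ 21 ∷ 22 ∷ 23 ∷ 24 ∷ 25 ∷ 27 ∷ 28 ∷ 29 ∷ 30 ∷ 31 ∷ 32 ∷ 35 ∷ 36 ∷ [])

-- Involutions in abelian groups of order 16

opaque
  8≡u*d-mod16 : ∀ {d} → 0 < d → d < 16 → ∃₂ λ u r → u ℕ.* d ≡ 8 ℕ.+ r ℕ.* 16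
  8≡u*d-mod16 {d} 0<d d<16 = subst (λ d → ∃₂ λ u r → u ℕ.* d ≡ 8 ℕ.+ r ℕ.* 16) (toℕ-fromℕ< d<16)
    (table (fromℕ< d<16) (subst (0 <_) (sym (toℕ-fromℕ< d<16)) 0<d))
    where
    table : ∀ (d : Fin 16) → 0 < toℕ d → ∃₂ λ u r → u ℕ.* toℕ d ≡ 8 ℕ.+ r ℕ.* 16
    table d 0<d = let u , r , eq = decided d 0<d in toℕ u , toℕ r , eq
      where
      decided : ∀ (d : Fin 16) → 0 < toℕ d → ∃₂ λ (u r : Fin 16) → toℕ u ℕ.* toℕ d ≡ 8 ℕ.+ toℕ r ℕ.* 16
      decided = toWitness {a? = all? λ d → (0 ℕ.<? toℕ d) →-dec
                                  any? λ u → any? λ r → toℕ u ℕ.* toℕ d ℕ.≟ 8 ℕ.+ toℕ r ℕ.* 16} _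

module MultiplesOnFin {n : ℕ} {_+_ : Op₂ (Fin n)} {0# : Fin n} { -_ : Op₁ (Fin n)}
                      (isAbelianGroup : IsAbelianGroup _≡_ _+_ 0# -_) where
  open AbelianGroupOnFin isAbelianGroup
  open AbelianGroup abelianGroup using (monoid; commutativeMonoid)
  open MonoidMult monoid public using (×-homo-+; ×-assocˡ) renaming (_×_ to _⋆_)
  open CommutativeMonoidSum commutativeMonoid using (sum; sum-permute; ∑-distrib-+; sum-replicate)
  open ≡-Reasoning

  multiple≡⋆ : ∀ k g → multiple _+_ 0# k g ≡ k ⋆ g
  multiple≡⋆ zero    g = refl
  multiple≡⋆ (suc k) g = cong (g +_) (multiple≡⋆ k g)

  ⋆-zeroʳ : ∀ k → k ⋆ 0# ≡ 0#
  ⋆-zeroʳ zero    = refl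
  ⋆-zeroʳ (suc k) = trans (identityˡ (k ⋆ 0#)) (⋆-zeroʳ k)

  n⋆g≡0 : ∀ g → n ⋆ g ≡ 0#
  n⋆g≡0 g = identityʳ-unique Σ (n ⋆ g) (begin
    Σ + (n ⋆ g)                       ≡⟨ cong (Σ +_) (sum-replicate n) ⟨
    Σ + sum (replicate n g)           ≡⟨ ∑-distrib-+ (λ a → a) (replicate n g) ⟨
    sum (λ a → a + g)                 ≡⟨ sum-permute (λ a → a) (translation g) ⟨
    Σ                                 ∎)
    where Σ = sum (λ a → a)

  double : Fin n → Fin n
  double x = x + x

  8⋆≡double³ : ∀ x → 8 ⋆ x ≡ double (double (double x))
  8⋆≡double³ x = begin
    8 ⋆ x              ≡⟨ ×-assocˡ x 2 4 ⟨
    2 ⋆ (4 ⋆ x)        ≡⟨ 2⋆≡double (4 ⋆ x) ⟩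
    double (4 ⋆ x)     ≡⟨ cong double (trans (sym (2⋆≡double (2 ⋆ x))) (×-assocˡ x 2 2)) ⟨
    double (double (2 ⋆ x)) ≡⟨ cong (double ∘ double) (2⋆≡double x) ⟩
    double (double (double x)) ∎
    where
    2⋆≡double : ∀ y → 2 ⋆ y ≡ double y
    2⋆≡double y = cong (y +_) (identityʳ y)

  module AtMostOneInvolution (t : Fin n) (involution⇒0∨t : ∀ x → double x ≡ 0# → x ≡ 0# ⊎ x ≡ t) where

    halves : ∀ y → ∃ λ r → ∀ x → double x ≡ y → x ∈ r ∷ t + r ∷ []
    halves y = from-decision (any? λ r → double r ≟ y)
      where
      from-decision : Dec (∃ λ r → double r ≡ y) → ∃ λ r → ∀ x → double x ≡ y → x ∈ r ∷ t + r ∷ []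
      from-decision (no ∄r) = y , λ x x+x≡y → contradiction (x , x+x≡y) ∄r
      from-decision (yes (r , r+r≡y)) = r , λ x x+x≡y →
        shifted-root x (involution⇒0∨t (x + (- r)) (difference-doubles x x+x≡y))
        where
        difference-doubles : ∀ x → double x ≡ y → double (x + (- r)) ≡ 0#
        difference-doubles x x+x≡y = begin
          (x + (- r)) + (x + (- r))     ≡⟨ interchange x (- r) x (- r) ⟩
          (x + x) + ((- r) + (- r))     ≡⟨ cong (_+ ((- r) + (- r))) (trans x+x≡y (sym r+r≡y)) ⟩
          (r + r) + ((- r) + (- r))     ≡⟨ interchange r r (- r) (- r) ⟩
          (r + (- r)) + (r + (- r))     ≡⟨ cong₂ _+_ (inverseʳ r) (inverseʳ r) ⟩
          0# + 0#                       ≡⟨ identityˡ 0# ⟩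
          0#                            ∎
        shifted-root : ∀ x → x + (- r) ≡ 0# ⊎ x + (- r) ≡ t → x ∈ r ∷ t + r ∷ []
        shifted-root x (inj₁ x-r≡0) = here (trans (sym (//-rightDividesˡ r x)) (trans (cong (_+ r) x-r≡0) (identityˡ r)))
        shifted-root x (inj₂ x-r≡t) = there (here (trans (sym (//-rightDividesˡ r x)) (cong (_+ r) x-r≡t)))

    roots : Fin n → List (Fin n)
    roots y = proj₁ (halves y) ∷ t + proj₁ (halves y) ∷ []

    eighthRoots : List (Fin n)
    eighthRoots = concatMap roots (concatMap roots (0# ∷ t ∷ []))

    ∈-eighthRoots : ∀ x → 8 ⋆ x ≡ 0# → x ∈ eighthRoots
    ∈-eighthRoots x 8⋆x≡0 = ∈-concatMap⁺ roots (lose (∈-concatMap⁺ roots (lose 4x∈ (∈-roots refl))) (∈-roots refl))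
      where
      ∈-roots : ∀ {x y} → double x ≡ y → x ∈ roots y
      ∈-roots {x} {y} = proj₂ (halves y) x
      4x∈ : double (double x) ∈ 0# ∷ t ∷ []
      4x∈ with involution⇒0∨t (double (double x)) (trans (sym (8⋆≡double³ x)) 8⋆x≡0)
      ... | inj₁ ≡0 = here ≡0
      ... | inj₂ ≡t = there (here ≡t)

    ∃8⋆≢0 : 8 < n → ∃ λ g → 8 ⋆ g ≢ 0#
    ∃8⋆≢0 8<n = let g , g∉ = ∃∉ eighthRoots 8<n in g , g∉ ∘ ∈-eighthRoots g

module AbelianGroupOfOrder16 {_+_ : Op₂ (Fin 16)} {0# : Fin 16} { -_ : Op₁ (Fin 16)}
                             (isAbelianGroup : IsAbelianGroup _≡_ _+_ 0# -_) where
  open AbelianGroupOnFin isAbelianGroup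
  open MultiplesOnFin isAbelianGroup
  open ≡-Reasoning

  ⋆≡0⇒8⋆≡0 : ∀ {d} g → 0 < d → d < 16 → d ⋆ g ≡ 0# → 8 ⋆ g ≡ 0#
  ⋆≡0⇒8⋆≡0 {d} g 0<d d<16 d⋆g≡0 = let u , r , u*d≡8+r*16 = 8≡u*d-mod16 0<d d<16 in begin
    8 ⋆ g                                ≡⟨ identityʳ (8 ⋆ g) ⟨
    (8 ⋆ g) + 0#                         ≡⟨ cong ((8 ⋆ g) +_) (trans (cong (r ⋆_) (n⋆g≡0 g)) (⋆-zeroʳ r)) ⟨
    (8 ⋆ g) + (r ⋆ (16 ⋆ g))             ≡⟨ cong ((8 ⋆ g) +_) (×-assocˡ g r 16) ⟩
    (8 ⋆ g) + ((r ℕ.* 16) ⋆ g)           ≡⟨ ×-homo-+ g 8 (r ℕ.* 16) ⟨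
    (8 ℕ.+ r ℕ.* 16) ⋆ g                 ≡⟨ cong (_⋆ g) u*d≡8+r*16 ⟨
    (u ℕ.* d) ⋆ g                        ≡⟨ ×-assocˡ g u d ⟨
    u ⋆ (d ⋆ g)                          ≡⟨ cong (u ⋆_) d⋆g≡0 ⟩
    u ⋆ 0#                               ≡⟨ ⋆-zeroʳ u ⟩
    0#                                   ∎

  8⋆≢0⇒cyclic : ∀ g → 8 ⋆ g ≢ 0# → IsCyclic _+_ 0#
  8⋆≢0⇒cyclic g 8⋆g≢0 = g , λ x →
    let i , i⋆g≡x = injective⇒preimage multiples-injective x in toℕ i , trans (multiple≡⋆ (toℕ i) g) i⋆g≡x
    where
    multiples-distinct : ∀ {i j : Fin 16} → i Fin.< j → toℕ i ⋆ g ≢ toℕ j ⋆ g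
    multiples-distinct {i} {j} i<j i⋆g≡j⋆g =
      8⋆g≢0 (⋆≡0⇒8⋆≡0 g (ℕ.m<n⇒0<n∸m i<j) (ℕ.≤-<-trans (ℕ.m∸n≤m (toℕ j) (toℕ i)) (toℕ<n j))
                      (identityʳ-unique (toℕ i ⋆ g) _ (begin
        (toℕ i ⋆ g) + ((toℕ j ∸ toℕ i) ⋆ g) ≡⟨ ×-homo-+ g (toℕ i) (toℕ j ∸ toℕ i) ⟨
        (toℕ i ℕ.+ (toℕ j ∸ toℕ i)) ⋆ g     ≡⟨ cong (_⋆ g) (ℕ.m+[n∸m]≡n (ℕ.<⇒≤ i<j)) ⟩
        toℕ j ⋆ g                           ≡⟨ i⋆g≡j⋆g ⟨
        toℕ i ⋆ g                           ∎)))
    multiples-injective : Injective _≡_ _≡_ (λ (i : Fin 16) → toℕ i ⋆ g)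
    multiples-injective {i} {j} i⋆g≡j⋆g with Fin.<-cmp i j
    ... | tri< i<j _ _ = contradiction i⋆g≡j⋆g (multiples-distinct i<j)
    ... | tri≈ _ i≡j _ = i≡j
    ... | tri> _ _ j<i = contradiction (sym i⋆g≡j⋆g) (multiples-distinct j<i)

  record TwoInvolutions : Set where
    field
      e₁ e₂   : Fin 16
      e₁≢0    : e₁ ≢ 0#
      e₂≢0    : e₂ ≢ 0#
      e₁≢e₂   : e₁ ≢ e₂
      e₁+e₁≡0 : e₁ + e₁ ≡ 0#
      e₂+e₂≡0 : e₂ + e₂ ≡ 0#

  noncyclic⇒twoInvolutions : ¬ IsCyclic _+_ 0# → TwoInvolutions
  noncyclic⇒twoInvolutions ¬cyclic = from-decision (any? λ e₁ → any? λ e₂ →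
    ¬? (e₁ ≟ 0#) ×-dec ¬? (e₂ ≟ 0#) ×-dec ¬? (e₁ ≟ e₂) ×-dec double e₁ ≟ 0# ×-dec double e₂ ≟ 0#)
    where
    from-decision : Dec (∃₂ λ e₁ e₂ → e₁ ≢ 0# × e₂ ≢ 0# × e₁ ≢ e₂ × double e₁ ≡ 0# × double e₂ ≡ 0#) →
                    TwoInvolutions
    from-decision (yes (e₁ , e₂ , e₁≢0 , e₂≢0 , e₁≢e₂ , e₁+e₁≡0 , e₂+e₂≡0)) =
      record { e₁ = e₁ ; e₂ = e₂ ; e₁≢0 = e₁≢0 ; e₂≢0 = e₂≢0 ; e₁≢e₂ = e₁≢e₂
             ; e₁+e₁≡0 = e₁+e₁≡0 ; e₂+e₂≡0 = e₂+e₂≡0 }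
    from-decision (no ∄) = contradiction (uncurry 8⋆≢0⇒cyclic (∃8⋆≢0 (toWitness {a? = 8 ℕ.<? 16} _))) ¬cyclic
      where
      atMostOne : Dec (∃ λ t → t ≢ 0# × double t ≡ 0#) → ∃ λ t → ∀ x → double x ≡ 0# → x ≡ 0# ⊎ x ≡ t
      atMostOne (yes (t , t≢0 , t+t≡0)) = t , λ x x+x≡0 → decidable-stable ((x ≟ 0#) ⊎-dec (x ≟ t)) λ neither →
        ∄ (x , t , neither ∘ inj₁ , t≢0 , neither ∘ inj₂ , x+x≡0 , t+t≡0)
      atMostOne (no ∄t) = 0# , λ x x+x≡0 → decidable-stable ((x ≟ 0#) ⊎-dec (x ≟ 0#)) λ neither →
        ∄t (x , neither ∘ inj₁ , x+x≡0)
      involution = atMostOne (any? λ t → ¬? (t ≟ 0#) ×-dec double t ≟ 0#)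
      open AtMostOneInvolution (proj₁ involution) (proj₂ involution)

-- A (16, 6, 2) difference set

V₄ : Set
V₄ = Bool × Bool

_⊕_ : V₄ → V₄ → V₄
(p , q) ⊕ (p′ , q′) = p xor p′ , q xor q′

xor≡false⇒≡ : ∀ x y → x xor y ≡ false → x ≡ y
xor≡false⇒≡ false false _ = refl
xor≡false⇒≡ true  true  _ = refl

⊕≡0⇒≡ : ∀ ε ε′ → ε ⊕ ε′ ≡ (false , false) → ε ≡ ε′
⊕≡0⇒≡ (p , q) (p′ , q′) ε⊕ε′≡0 =
  cong₂ _,_ (xor≡false⇒≡ p p′ (cong proj₁ ε⊕ε′≡0)) (xor≡false⇒≡ q q′ (cong proj₂ ε⊕ε′≡0))

⊕-self : ∀ ε → ε ⊕ ε ≡ (false , false)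
⊕-self (p , q) = cong₂ _,_ (xor-same p) (xor-same q)

_≟ⱽ_ : (ε ε′ : V₄) → Dec (ε ≡ ε′)
_≟ⱽ_ = ≡-dec _≟ᵇ_ _≟ᵇ_

V₄-elements : List V₄
V₄-elements = (false , false) ∷ (false , true) ∷ (true , false) ∷ (true , true) ∷ []

∈-V₄-elements : ∀ ε → ε ∈ V₄-elements
∈-V₄-elements (false , false) = here refl
∈-V₄-elements (false , true)  = there (here refl)
∈-V₄-elements (true  , false) = there (there (here refl))
∈-V₄-elements (true  , true)  = there (there (there (here refl)))

Exhaustible : Set → Set₁
Exhaustible X = ∀ {Q : X → Set} → (∀ x → Dec (Q x)) → Dec (∀ x → Q x)

exhaustible-Bool : Exhaustible Bool
exhaustible-Bool Q? = map′ (λ (q-false , q-true) → λ { false → q-false ; true → q-true })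
                           (λ q → q false , q true) (Q? false ×-dec Q? true)

exhaustible-× : ∀ {X Y} → Exhaustible X → Exhaustible Y → Exhaustible (X × Y)
exhaustible-× ∀X? ∀Y? Q? = map′ (λ q (x , y) → q x y) (λ q x y → q (x , y)) (∀X? λ x → ∀Y? λ y → Q? (x , y))

exhaustible-Vec : ∀ {X} → Exhaustible X → ∀ n → Exhaustible (Vec X n)
exhaustible-Vec ∀X? zero    Q? = map′ (λ { q [] → q }) (λ q → q []) (Q? [])
exhaustible-Vec ∀X? (suc n) Q? = map′ (λ { q (x ∷ xs) → q x xs }) (λ q x xs → q (x ∷ xs))
                                        (∀X? λ x → exhaustible-Vec ∀X? n λ xs → Q? (x ∷ xs))

exhaustible-V₄ : Exhaustible V₄
exhaustible-V₄ = exhaustible-× exhaustible-Bool exhaustible-Bool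

-- (i , ε) stands for rep i + ψ ε: the i-th coset of E ≅ V₄, shifted by ε (see φ below).
Coordinates : Set
Coordinates = Fin 4 × V₄

bits : Fin 4 → V₄
bits 0F = false , false
bits 1F = false , true
bits 2F = true  , false
bits 3F = true  , true

unbits : V₄ → Fin 4
unbits (false , false) = 0F
unbits (false , true)  = 1F
unbits (true  , false) = 2F
unbits (true  , true)  = 3F

unbits-bits : ∀ i → unbits (bits i) ≡ i
unbits-bits 0F = refl
unbits-bits 1F = refl
unbits-bits 2F = refl
unbits-bits 3F = refl

code : Fin 16 → Coordinates
code = map₂ bits ∘ remQuot 4

code-injective : Injective _≡_ _≡_ code
code-injective {k} {k′} code-k≡code-k′ = trans (sym (uncode-code k)) (trans (cong uncode code-k≡code-k′) (uncode-code k′))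
  where
  uncode : Coordinates → Fin 16
  uncode (i , ε) = combine i (unbits ε)
  uncode-code : ∀ k → uncode (code k) ≡ k
  uncode-code k = trans (cong (combine (proj₁ (remQuot {4} 4 k))) (unbits-bits (proj₂ (remQuot {4} 4 k))))
                        (combine-remQuot {4} 4 k)

shift : (Fin 4 → Coordinates) → Coordinates → Coordinates
shift σ (i , ε) = proj₁ (σ i) , proj₂ (σ i) ⊕ ε

shift-cong : ∀ {σ σ′} → (∀ i → σ i ≡ σ′ i) → ∀ p → shift σ p ≡ shift σ′ p
shift-cong σ≗σ′ (i , ε) = cong (λ c → proj₁ c , proj₂ c ⊕ ε) (σ≗σ′ i)

-- In the cosets 0, 1, 2 of E, Z₀ picks out the subgroups {0, e₁}, {0, e₂}, {0, e₁ + e₂} of E.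
Z₀ : Coordinates → Bool
Z₀ (0F , p , q) = not q
Z₀ (1F , p , q) = not p
Z₀ (2F , p , q) = not (p xor q)
Z₀ (3F , _)     = false

shiftCount : (Fin 4 → Coordinates) → ℕ
shiftCount σ = countFin (λ k → Z₀ (code k) ∧ Z₀ (shift σ (code k)))

shiftCount-cong : ∀ {σ σ′} → (∀ i → σ i ≡ σ′ i) → shiftCount σ ≡ shiftCount σ′
shiftCount-cong σ≗σ′ = countFin-cong λ k → cong (λ c → Z₀ (code k) ∧ Z₀ c) (shift-cong σ≗σ′ (code k))

IsDerangement : (Fin 4 → Fin 4) → Set
IsDerangement τ = (∀ i j → τ i ≡ τ j → i ≡ j) × (∀ i → τ i ≢ i)

isDerangement? : ∀ τ → Dec (IsDerangement τ)
isDerangement? τ = (all? λ i → all? λ j → (τ i ≟ τ j) →-dec (i ≟ j)) ×-dec (all? λ i → ¬? (τ i ≟ i))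

-- Translation by d ≠ 0 either fixes every coset of E, and then shifts all of them by the same
-- nonzero ε, or permutes the cosets without fixed points; the two checks cover these cases.
shiftCount-derangement : ∀ (τ : Vec (Fin 4) 4) → IsDerangement (lookup τ) →
                         ∀ (δ : Vec V₄ 4) → shiftCount (λ i → lookup τ i , lookup δ i) ≡ 2
shiftCount-derangement = toWitness {a? = exhaustible-Vec all? 4 λ τ → isDerangement? (lookup τ) →-dec
                                         exhaustible-Vec exhaustible-V₄ 4 λ δ →
                                         shiftCount (λ i → lookup τ i , lookup δ i) ℕ.≟ 2} _

shiftCount-translation : ∀ ε → ε ≢ (false , false) → shiftCount (λ i → i , ε) ≡ 2
shiftCount-translation = toWitness {a? = exhaustible-V₄ λ ε → ¬? (ε ≟ⱽ (false , false)) →-dec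
                                         shiftCount (λ i → i , ε) ℕ.≟ 2} _

module DifferenceSetOfOrder16 {_+_ : Op₂ (Fin 16)} {0# : Fin 16} { -_ : Op₁ (Fin 16)}
         (isAbelianGroup : IsAbelianGroup _≡_ _+_ 0# -_)
         (involutions : AbelianGroupOfOrder16.TwoInvolutions isAbelianGroup) where
  open AbelianGroupOnFin isAbelianGroup
  open AbelianGroupOfOrder16.TwoInvolutions involutions
  open ≡-Reasoning

  choose : Bool → Fin 16 → Fin 16
  choose b x = if b then x else 0#

  choose-xor : ∀ b b′ {x} → x + x ≡ 0# → choose (b xor b′) x ≡ choose b x + choose b′ x
  choose-xor false false x+x≡0 = sym (identityˡ 0#)
  choose-xor false true  x+x≡0 = sym (identityˡ _)
  choose-xor true  false x+x≡0 = sym (identityʳ _)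
  choose-xor true  true  x+x≡0 = sym x+x≡0

  ψ : V₄ → Fin 16
  ψ (p , q) = choose p e₁ + choose q e₂

  ψ-⊕ : ∀ ε ε′ → ψ (ε ⊕ ε′) ≡ ψ ε + ψ ε′
  ψ-⊕ (p , q) (p′ , q′) = trans (cong₂ _+_ (choose-xor p p′ e₁+e₁≡0) (choose-xor q q′ e₂+e₂≡0))
                                (interchange _ _ _ _)

  ψ-0 : ψ (false , false) ≡ 0#
  ψ-0 = identityˡ 0#

  ψ+ψ≡0 : ∀ ε → ψ ε + ψ ε ≡ 0#
  ψ+ψ≡0 ε = trans (sym (ψ-⊕ ε ε)) (trans (cong ψ (⊕-self ε)) ψ-0)

  +ψ+ψ : ∀ g ε → (g + ψ ε) + ψ ε ≡ g
  +ψ+ψ g ε = trans (assoc g (ψ ε) (ψ ε)) (trans (cong (g +_) (ψ+ψ≡0 ε)) (identityʳ g))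

  ψ≡0⇒≡0 : ∀ ε → ψ ε ≡ 0# → ε ≡ (false , false)
  ψ≡0⇒≡0 (false , false) _   = refl
  ψ≡0⇒≡0 (false , true)  ψ≡0 = contradiction (trans (sym (identityˡ e₂)) ψ≡0) e₂≢0
  ψ≡0⇒≡0 (true  , false) ψ≡0 = contradiction (trans (sym (identityʳ e₁)) ψ≡0) e₁≢0
  ψ≡0⇒≡0 (true  , true)  ψ≡0 = contradiction (begin
    e₁                ≡⟨ identityʳ e₁ ⟨
    e₁ + 0#           ≡⟨ cong (e₁ +_) e₂+e₂≡0 ⟨
    e₁ + (e₂ + e₂)    ≡⟨ assoc e₁ e₂ e₂ ⟨
    (e₁ + e₂) + e₂    ≡⟨ cong (_+ e₂) ψ≡0 ⟩
    0# + e₂           ≡⟨ identityˡ e₂ ⟩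
    e₂                ∎) e₁≢e₂

  ψ-injective : Injective _≡_ _≡_ ψ
  ψ-injective {ε} {ε′} ψε≡ψε′ = ⊕≡0⇒≡ ε ε′ (ψ≡0⇒≡0 (ε ⊕ ε′) (begin
    ψ (ε ⊕ ε′)        ≡⟨ ψ-⊕ ε ε′ ⟩
    ψ ε + ψ ε′        ≡⟨ cong (_+ ψ ε′) ψε≡ψε′ ⟩
    ψ ε′ + ψ ε′       ≡⟨ ψ+ψ≡0 ε′ ⟩
    0#                ∎))

  coset : Fin 16 → List (Fin 16)
  coset g = map (λ ε → g + ψ ε) V₄-elements

  ∈-coset : ∀ g ε → g + ψ ε ∈ coset g
  ∈-coset g ε = ∈-map⁺ (λ ε → g + ψ ε) (∈-V₄-elements ε)

  outside : (xs : List (Fin 16)) → {True (length xs ℕ.<? 16)} → ∃ λ g → g ∉ xs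
  outside xs {|xs|<16} = ∃∉ xs (toWitness |xs|<16)

  cosets₁ : List (Fin 16)
  cosets₁ = coset 0#

  g₁ : ∃ (_∉ cosets₁)
  g₁ = outside cosets₁

  cosets₂ : List (Fin 16)
  cosets₂ = cosets₁ ++ coset (proj₁ g₁)

  g₂ : ∃ (_∉ cosets₂)
  g₂ = outside cosets₂

  cosets₃ : List (Fin 16)
  cosets₃ = cosets₂ ++ coset (proj₁ g₂)

  g₃ : ∃ (_∉ cosets₃)
  g₃ = outside cosets₃

  rep : Fin 4 → Fin 16
  rep 0F = 0#
  rep 1F = proj₁ g₁
  rep 2F = proj₁ g₂
  rep 3F = proj₁ g₃

  ∉⇒≢ : ∀ {xs : List (Fin 16)} {y x} → y ∉ xs → x ∈ xs → y ≢ x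
  ∉⇒≢ y∉xs x∈xs refl = y∉xs x∈xs

  cosets₂⊆cosets₃ : ∀ {x} → x ∈ cosets₂ → x ∈ cosets₃
  cosets₂⊆cosets₃ = ∈-++⁺ˡ

  rep-new : ∀ {i j} → j Fin.< i → ∀ ε → rep i ≢ rep j + ψ ε
  rep-new {1F} {0F} _ ε = ∉⇒≢ (proj₂ g₁) (∈-coset 0# ε)
  rep-new {2F} {0F} _ ε = ∉⇒≢ (proj₂ g₂) (∈-++⁺ˡ (∈-coset 0# ε))
  rep-new {2F} {1F} _ ε = ∉⇒≢ (proj₂ g₂) (∈-++⁺ʳ cosets₁ (∈-coset (proj₁ g₁) ε))
  rep-new {3F} {0F} _ ε = ∉⇒≢ (proj₂ g₃) (cosets₂⊆cosets₃ (∈-++⁺ˡ (∈-coset 0# ε)))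
  rep-new {3F} {1F} _ ε = ∉⇒≢ (proj₂ g₃) (cosets₂⊆cosets₃ (∈-++⁺ʳ cosets₁ (∈-coset (proj₁ g₁) ε)))
  rep-new {3F} {2F} _ ε = ∉⇒≢ (proj₂ g₃) (∈-++⁺ʳ cosets₂ (∈-coset (proj₁ g₂) ε))
  rep-new {0F} ()
  rep-new {1F} {Fin.suc _} (s≤s ())
  rep-new {2F} {Fin.suc (Fin.suc _)} (s≤s (s≤s ()))
  rep-new {3F} {Fin.suc (Fin.suc (Fin.suc _))} (s≤s (s≤s (s≤s ())))

  rep-separated : ∀ {i j} → i ≢ j → ∀ ε → rep i ≢ rep j + ψ ε
  rep-separated {i} {j} i≢j ε repi≡repj+ψε with Fin.<-cmp i j
  ... | tri< i<j _ _ = rep-new i<j ε (begin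
    rep j                  ≡⟨ +ψ+ψ (rep j) ε ⟨
    (rep j + ψ ε) + ψ ε    ≡⟨ cong (_+ ψ ε) repi≡repj+ψε ⟨
    rep i + ψ ε            ∎)
  ... | tri≈ _ i≡j _ = i≢j i≡j
  ... | tri> _ _ j<i = rep-new j<i ε repi≡repj+ψε

  φ : Coordinates → Fin 16
  φ (i , ε) = rep i + ψ ε

  φ-injective : Injective _≡_ _≡_ φ
  φ-injective {i , ε} {j , ε′} φ≡φ with i ≟ j
  ... | yes refl = cong (i ,_) (ψ-injective (∙-cancelˡ (rep i) (ψ ε) (ψ ε′) φ≡φ))
  ... | no i≢j   = contradiction (begin
    rep i                     ≡⟨ +ψ+ψ (rep i) ε ⟨
    (rep i + ψ ε) + ψ ε       ≡⟨ cong (_+ ψ ε) φ≡φ ⟩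
    (rep j + ψ ε′) + ψ ε      ≡⟨ assoc (rep j) (ψ ε′) (ψ ε) ⟩
    rep j + (ψ ε′ + ψ ε)      ≡⟨ cong (rep j +_) (ψ-⊕ ε′ ε) ⟨
    rep j + ψ (ε′ ⊕ ε)        ∎) (rep-separated i≢j (ε′ ⊕ ε))

  Φ : Fin 16 → Fin 16
  Φ = φ ∘ code

  Φ-injective : Injective _≡_ _≡_ Φ
  Φ-injective = code-injective ∘ φ-injective

  Φ⁻¹ : Fin 16 → Fin 16
  Φ⁻¹ a = proj₁ (injective⇒preimage Φ-injective a)

  Φ-Φ⁻¹ : ∀ a → Φ (Φ⁻¹ a) ≡ a
  Φ-Φ⁻¹ a = proj₂ (injective⇒preimage Φ-injective a)

  coordinatePermutation : Permutation′ 16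
  coordinatePermutation = permutation Φ Φ⁻¹ Φ-Φ⁻¹ (λ k → Φ-injective (Φ-Φ⁻¹ (Φ k)))

  coord : Fin 16 → Coordinates
  coord = code ∘ Φ⁻¹

  φ-coord : ∀ a → φ (coord a) ≡ a
  φ-coord = Φ-Φ⁻¹

  coord-φ : ∀ p → coord (φ p) ≡ p
  coord-φ p = φ-injective (φ-coord (φ p))

  translationPattern : Fin 16 → Fin 4 → Coordinates
  translationPattern d i = coord (rep i + d)

  module _ (d : Fin 16) where
    private
      τ = proj₁ ∘ translationPattern d
      δ = proj₂ ∘ translationPattern d

      rep+d : ∀ i → rep (τ i) + ψ (δ i) ≡ rep i + d
      rep+d i = φ-coord (rep i + d)

    φ-shift : ∀ p → φ (shift (translationPattern d) p) ≡ φ p + d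
    φ-shift (i , ε) = begin
      rep (τ i) + ψ (δ i ⊕ ε)         ≡⟨ cong (rep (τ i) +_) (ψ-⊕ (δ i) ε) ⟩
      rep (τ i) + (ψ (δ i) + ψ ε)     ≡⟨ assoc (rep (τ i)) (ψ (δ i)) (ψ ε) ⟨
      (rep (τ i) + ψ (δ i)) + ψ ε     ≡⟨ cong (_+ ψ ε) (rep+d i) ⟩
      (rep i + d) + ψ ε               ≡⟨ xy∙z≈xz∙y (rep i) d (ψ ε) ⟩
      (rep i + ψ ε) + d               ∎

    translationPattern-injective : ∀ i j → τ i ≡ τ j → i ≡ j
    translationPattern-injective i j τi≡τj = cong proj₁ (φ-injective (∙-cancelʳ d _ _ (begin
      (rep i + ψ (δ j)) + d           ≡⟨ xy∙z≈xz∙y (rep i) (ψ (δ j)) d ⟩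
      (rep i + d) + ψ (δ j)           ≡⟨ cong (_+ ψ (δ j)) (rep+d i) ⟨
      (rep (τ i) + ψ (δ i)) + ψ (δ j) ≡⟨ xy∙z≈xz∙y (rep (τ i)) (ψ (δ i)) (ψ (δ j)) ⟩
      (rep (τ i) + ψ (δ j)) + ψ (δ i) ≡⟨ cong (λ k → (rep k + ψ (δ j)) + ψ (δ i)) τi≡τj ⟩
      (rep (τ j) + ψ (δ j)) + ψ (δ i) ≡⟨ cong (_+ ψ (δ i)) (rep+d j) ⟩
      (rep j + d) + ψ (δ i)           ≡⟨ xy∙z≈xz∙y (rep j) d (ψ (δ i)) ⟩
      (rep j + ψ (δ i)) + d           ∎)))

    translationPattern-fixed⇒d≡ψ : ∀ i → τ i ≡ i → d ≡ ψ (δ i)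
    translationPattern-fixed⇒d≡ψ i τi≡i =
      ∙-cancelˡ (rep i) d (ψ (δ i)) (trans (sym (rep+d i)) (cong (λ k → rep k + ψ (δ i)) τi≡i))

    translationPattern-fixed : ∀ i → τ i ≡ i → ∀ j → translationPattern d j ≡ (j , δ i)
    translationPattern-fixed i τi≡i j = φ-injective (begin
      φ (translationPattern d j)  ≡⟨ φ-coord (rep j + d) ⟩
      rep j + d                   ≡⟨ cong (rep j +_) (translationPattern-fixed⇒d≡ψ i τi≡i) ⟩
      rep j + ψ (δ i)             ∎)

  Z : Fin 16 → Bool
  Z = Z₀ ∘ coord

  Z-shiftCount : ∀ d → countFin (λ a → Z a ∧ Z (a + d)) ≡ shiftCount (translationPattern d)
  Z-shiftCount d = begin
    countFin (λ a → Z a ∧ Z (a + d))           ≡⟨ countFin-permute coordinatePermutation (λ a → Z a ∧ Z (a + d)) ⟨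
    countFin (λ k → Z (Φ k) ∧ Z (Φ k + d))     ≡⟨ countFin-cong (λ k → cong₂ (λ p q → Z₀ p ∧ Z₀ q)
                                                    (coord-φ (code k)) (coord-shift (code k))) ⟩
    shiftCount (translationPattern d)          ∎
    where
    coord-shift : ∀ p → coord (φ p + d) ≡ shift (translationPattern d) p
    coord-shift p = trans (cong coord (sym (φ-shift d p))) (coord-φ _)

  Z-isDifferenceSet : IsDifferenceSet Z 2
  Z-isDifferenceSet d d≢0 = trans (Z-shiftCount d) (shiftCount≡2 (any? λ i → τ i ≟ i))
    where
    τ = proj₁ ∘ translationPattern d
    δ = proj₂ ∘ translationPattern d
    shiftCount≡2 : Dec (∃ λ i → τ i ≡ i) → shiftCount (translationPattern d) ≡ 2
    shiftCount≡2 (yes (i , τi≡i)) =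
      trans (shiftCount-cong (translationPattern-fixed d i τi≡i))
            (shiftCount-translation (δ i) λ δi≡0 →
              d≢0 (trans (translationPattern-fixed⇒d≡ψ d i τi≡i) (trans (cong ψ δi≡0) ψ-0)))
    shiftCount≡2 (no ∄fixed) =
      trans (shiftCount-cong (λ i → sym (cong₂ _,_ (lookup∘tabulate τ i) (lookup∘tabulate δ i))))
            (shiftCount-derangement (tabulate τ) derangement (tabulate δ))
      where
      derangement : IsDerangement (lookup (tabulate τ))
      derangement = (λ i j τi≡τj → translationPattern-injective d i j
                      (trans (sym (lookup∘tabulate τ i)) (trans τi≡τj (lookup∘tabulate τ j))))
                  , (λ i τi≡i → ∄fixed (i , trans (sym (lookup∘tabulate τ i)) τi≡i))

  |Z|≡6 : countFin Z ≡ 6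
  |Z|≡6 = trans (sym (countFin-permute coordinatePermutation Z)) (countFin-cong (λ k → cong Z₀ (coord-φ (code k))))

  0∈Z : Z 0# ≡ true
  0∈Z = cong Z₀ (trans (cong coord 0≡φ0) (coord-φ (0F , false , false)))
    where
    0≡φ0 : 0# ≡ φ (0F , false , false)
    0≡φ0 = sym (trans (cong (0# +_) ψ-0) (identityˡ 0#))

strictlyDeza-32 : ∀ {_+_ : Op₂ (Fin 16)} {0# : Fin 16} { -_ : Op₁ (Fin 16)} →
                  IsAbelianGroup _≡_ _+_ 0# -_ → ¬ IsCyclic _+_ 0# →
                  StrictlyDezaCayleyGD _+_ 0# -_ 32 25 20 18
strictlyDeza-32 {0# = 0#} isAbelianGroup ¬cyclic =
  differenceSet⇒strictlyDezaCayley (not ∘ Z) |T|≡10 z<s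
    (complement-isDifferenceSet Z |Z|≡6 Z-isDifferenceSet) refl 0# (cong not 0∈Z)
  where
  open GeneralisedDihedralGroup isAbelianGroup
  open DifferenceSetOfOrder16 isAbelianGroup (AbelianGroupOfOrder16.noncyclic⇒twoInvolutions isAbelianGroup ¬cyclic)
  |T|≡10 : countFin (not ∘ Z) ≡ 10
  |T|≡10 = ℕ.+-cancelʳ-≡ 6 (countFin (not ∘ Z)) 10
             (trans (cong (countFin (not ∘ Z) ℕ.+_) (sym |Z|≡6)) (countFin-not Z))

corollary3p3 :
    StrictlyDezaCayleyDihedral 7 14 9 6 4 ×
    StrictlyDezaCayleyDihedral 11 22 16 12 10 ×
    StrictlyDezaCayleyDihedral 37 74 64 56 54 ×
    ((_+_ : Op₂ (Fin 16)) (0# : Fin 16) (-_ : Op₁ (Fin 16)) →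
      IsAbelianGroup _≡_ _+_ 0# -_ →
      ¬ IsCyclic _+_ 0# →
      StrictlyDezaCayleyGD _+_ 0# -_ 32 25 20 18)
corollary3p3 = strictlyDeza-14 , strictlyDeza-22 , strictlyDeza-74 , λ _ _ _ → strictlyDeza-32
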